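{- Let $G$ be a Naji graph with an edge $e=vw$, and suppose $G$ and $G-e$ share a Naji solution $\beta$ (i.e., $\beta$ satisfies both the Naji equations of $G$ and those of $G-e$). Then $\beta(x,v)\neq\beta(x,w)$ for all $x\in(N(v)\,\Delta\, N(w))\setminus\{v,w\}$, and $\beta(x,v)=\beta(x,w)$ for all $x\notin N(v)\,\Delta\, N(w)$.
   Context: All graphs are finite and simple; $N(u)$ is the open neighborhood of $u$ in $G$ and $\Delta$ is symmetric difference; $G-e$ has the same vertex set as $G$ with the edge $e$ removed. For a graph $H$ and each ordered pair $(v,w)$ of distinct vertices there is a variable $\beta(v,w)$. The Naji equations of $H$ are: (a) for each edge $vw$, $\beta(v,w)+\beta(w,v)=1$; (b) if $v,w,x$ are distinct with $vw\in E(H)$ and $vx,wx\notin E(H)$, then $\beta(x,v)+\beta(x,w)=0$; (c) if $v,w,x$ are distinct with $vw,vx\in E(H)$ and $wx\notin E(H)$, then $\beta(v,w)+\beta(v,x)+\beta(w,x)+\beta(x,w)=1$. A Naji solution of $H$ is a function from ordered pairs of distinct vertices to $GF(2)$ satisfying these equations; $H$ is a Naji graph if it has one. -}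

module Defs where

open import Data.Nat using (ℕ)
open import Data.Fin using (Fin; _≟_)
open import Data.Bool using (Bool; true; false; _xor_; _∧_; _∨_; if_then_else_)
open import Relation.Binary.PropositionalEquality using (_≡_; _≢_)
open import Relation.Nullary using (does)

Adj : ℕ → Set
Adj n = Fin n → Fin n → Bool

record IsSimple {n : ℕ} (A : Adj n) : Set where
  field
    sym   : ∀ u v → A u v ≡ A v u
    irref : ∀ u → A u u ≡ false

removeEdge : ∀ {n} → Adj n → Fin n → Fin n → Adj n
removeEdge A v w x y =
  if (does (x ≟ v) ∧ does (y ≟ w)) ∨ (does (x ≟ w) ∧ does (y ≟ v))
  then false else A x y

-- Candidate solutions: functions on ordered pairs with values in GF(2) = Bool
-- (addition = xor).  Values on the diagonal are irrelevant: the equations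
-- below only ever use pairs of distinct vertices.
Assignment : ℕ → Set
Assignment n = Fin n → Fin n → Bool

record NajiSolution {n : ℕ} (A : Adj n) (β : Assignment n) : Set where
  field
    eqA : ∀ v w → v ≢ w → A v w ≡ true → (β v w xor β w v) ≡ true
    eqB : ∀ v w x → v ≢ w → v ≢ x → w ≢ x →
          A v w ≡ true → A v x ≡ false → A w x ≡ false →
          (β x v xor β x w) ≡ false
    eqC : ∀ v w x → v ≢ w → v ≢ x → w ≢ x →
          A v w ≡ true → A v x ≡ true → A w x ≡ false →
          (β v w xor β v x xor β w x xor β x w) ≡ true

record IsNaji {n : ℕ} (A : Adj n) : Set where
  field
    solution : Assignment n
    isSol    : NajiSolution A solution

inSymDiff : ∀ {n} → Adj n → Fin n → Fin n → Fin n → Bool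
inSymDiff A v w x = A v x xor A w x

-- For x outside {v,w} the equations of G and of G − e together pin down β(x,v) + β(x,w) in GF(2).
-- If x is adjacent to neither endpoint, equation (b) of G gives 0. If x is adjacent to both,
-- (c) at x in G − e, where vw is no longer an edge, plus (a) at vw in G gives 0. If x is adjacent
-- to v only, the (a)-equations of vx and vw and the (c)-equation of v, w, x in G sum with the
-- (b)-equation of the edge vx and the vertex w in G − e to 1. So β(x,v) + β(x,w) is the indicator
-- of N(v) Δ N(w), and v, w themselves lie in N(v) Δ N(w) because vw is an edge.
module Submission where

open import Defs
open import Data.Nat using (ℕ)
open import Data.Fin using (Fin; _≟_)
open import Data.Bool using (Bool; true; false; _xor_)
open import Data.Bool.Properties using (xor-same; xor-comm; ∧-zeroʳ; xor-∧-commutativeRing)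
open import Data.Maybe using (Maybe; just; nothing)
open import Data.Product using (_×_; _,_)
open import Relation.Nullary using (does; contradiction)
open import Relation.Nullary.Decidable using (dec-true; dec-false)
open import Relation.Binary.PropositionalEquality
  using (_≡_; _≢_; refl; sym; trans; cong₂; ≢-sym; module ≡-Reasoning)
open import Tactic.RingSolver using (solve-∀)
open import Tactic.RingSolver.Core.AlmostCommutativeRing
  using (AlmostCommutativeRing; fromCommutativeRing)

false≟_ : (b : Bool) → Maybe (false ≡ b)
false≟ false = just refl
false≟ true  = nothing

-- Bool is its own coefficient ring here, so the solver reduces coefficients mod 2 and proves
-- cancellations such as a xor a ≡ false.
xor-∧-almostCommutativeRing : AlmostCommutativeRing _ _
xor-∧-almostCommutativeRing = fromCommutativeRing xor-∧-commutativeRing false≟_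

xor≡true⇒≢ : ∀ {a b} → a xor b ≡ true → a ≢ b
xor≡true⇒≢ {a} a⊕a≡true refl = contradiction (trans (sym (xor-same a)) a⊕a≡true) λ ()

xor≡false⇒≡ : ∀ {a b} → a xor b ≡ false → a ≡ b
xor≡false⇒≡ {false} {false} _ = refl
xor≡false⇒≡ {true}  {true}  _ = refl

module _ {n : ℕ} (G : Adj n) {v w : Fin n} where

  removeEdge-removes : removeEdge G v w v w ≡ false
  removeEdge-removes rewrite dec-true (v ≟ v) refl | dec-true (w ≟ w) refl = refl

  removeEdge-removes′ : v ≢ w → removeEdge G v w w v ≡ false
  removeEdge-removes′ v≢w
    rewrite dec-false (w ≟ v) (≢-sym v≢w) | dec-true (w ≟ w) refl | dec-true (v ≟ v) refl = refl

  removeEdge-row : ∀ {x} y → x ≢ v → x ≢ w → removeEdge G v w x y ≡ G x y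
  removeEdge-row {x} y x≢v x≢w rewrite dec-false (x ≟ v) x≢v | dec-false (x ≟ w) x≢w = refl

  removeEdge-column : ∀ {x} y → x ≢ v → x ≢ w → removeEdge G v w y x ≡ G y x
  removeEdge-column {x} y x≢v x≢w
    rewrite dec-false (x ≟ w) x≢w | dec-false (x ≟ v) x≢v
          | ∧-zeroʳ (does (y ≟ v)) | ∧-zeroʳ (does (y ≟ w)) = refl

module _ {n : ℕ} {G H : Adj n} {β : Assignment n}
         (solG : NajiSolution G β) (solH : NajiSolution H β) where

  private
    module SG = NajiSolution solG
    module SH = NajiSolution solH

  β-differs-on-private-neighbour :
    ∀ {v w x} → v ≢ w → v ≢ x → w ≢ x →
    G v w ≡ true → G v x ≡ true → G w x ≡ false →
    H v x ≡ true → H v w ≡ false → H x w ≡ false →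
    β x v xor β x w ≡ true
  β-differs-on-private-neighbour {v} {w} {x} v≢w v≢x w≢x Gvw Gvx Gwx Hvx Hvw Hxw = begin
    β x v xor β x w
      ≡⟨ regroup (β v x) (β x v) (β v w) (β w v) (β w x) (β x w) ⟩
    (β v x xor β x v) xor (β v w xor β w v)
      xor (β v w xor β v x xor β w x xor β x w) xor (β w v xor β w x)
      ≡⟨ cong₂ _xor_ (SG.eqA v x v≢x Gvx)
           (cong₂ _xor_ (SG.eqA v w v≢w Gvw)
             (cong₂ _xor_ (SG.eqC v w x v≢w v≢x w≢x Gvw Gvx Gwx)
               (SH.eqB v x w v≢x v≢w (≢-sym w≢x) Hvx Hvw Hxw))) ⟩
    true xor true xor true xor false
      ∎
    where
    open ≡-Reasoning
    regroup : ∀ a b c d e f →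
              b xor f ≡ (a xor b) xor (c xor d) xor (c xor a xor e xor f) xor (d xor e)
    regroup = solve-∀ xor-∧-almostCommutativeRing

  β-agrees-on-common-neighbour :
    ∀ {v w x} → v ≢ w → x ≢ v → x ≢ w →
    G v w ≡ true → H x v ≡ true → H x w ≡ true → H v w ≡ false →
    β x v xor β x w ≡ false
  β-agrees-on-common-neighbour {v} {w} {x} v≢w x≢v x≢w Gvw Hxv Hxw Hvw = begin
    β x v xor β x w
      ≡⟨ regroup (β x v) (β x w) (β v w) (β w v) ⟩
    (β x v xor β x w xor β v w xor β w v) xor (β v w xor β w v)
      ≡⟨ cong₂ _xor_ (SH.eqC x v w x≢v x≢w v≢w Hxv Hxw Hvw) (SG.eqA v w v≢w Gvw) ⟩
    true xor true
      ∎
    where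
    open ≡-Reasoning
    regroup : ∀ a b c d → a xor b ≡ (a xor b xor c xor d) xor (c xor d)
    regroup = solve-∀ xor-∧-almostCommutativeRing

module _ {n : ℕ} {G : Adj n} (simple : IsSimple G) {v w : Fin n} (Gvw : G v w ≡ true) where

  open IsSimple simple using (irref) renaming (sym to G-sym)

  private
    H : Adj n
    H = removeEdge G v w

    v≢w : v ≢ w
    v≢w refl = contradiction (trans (sym Gvw) (irref v)) λ ()

    H-row : ∀ {x b} y → x ≢ v → x ≢ w → G y x ≡ b → H x y ≡ b
    H-row {x} y x≢v x≢w Gyx = trans (removeEdge-row G y x≢v x≢w) (trans (G-sym x y) Gyx)

    H-column : ∀ {x b} y → x ≢ v → x ≢ w → G y x ≡ b → H y x ≡ b
    H-column y x≢v x≢w Gyx = trans (removeEdge-column G y x≢v x≢w) Gyx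

  inSymDiff-left : inSymDiff G v w v ≡ true
  inSymDiff-left rewrite irref v | G-sym w v = Gvw

  inSymDiff-right : inSymDiff G v w w ≡ true
  inSymDiff-right rewrite irref w | Gvw = refl

  xor-β≡inSymDiff : ∀ {β} → NajiSolution G β → NajiSolution H β →
                    ∀ {x} → x ≢ v → x ≢ w → β x v xor β x w ≡ inSymDiff G v w x
  xor-β≡inSymDiff {β} solG solH {x} x≢v x≢w with G v x in Gvx | G w x in Gwx
  ... | true  | true  =
    β-agrees-on-common-neighbour solG solH v≢w x≢v x≢w Gvw
      (H-row v x≢v x≢w Gvx) (H-row w x≢v x≢w Gwx) (removeEdge-removes G)
  ... | true  | false =
    β-differs-on-private-neighbour solG solH v≢w (≢-sym x≢v) (≢-sym x≢w)
      Gvw Gvx Gwx (H-column v x≢v x≢w Gvx) (removeEdge-removes G) (H-row w x≢v x≢w Gwx)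
  ... | false | true  = trans (xor-comm (β x v) (β x w))
    (β-differs-on-private-neighbour solG solH (≢-sym v≢w) (≢-sym x≢w) (≢-sym x≢v)
      (trans (G-sym w v) Gvw) Gwx Gvx
      (H-column w x≢v x≢w Gwx) (removeEdge-removes′ G v≢w) (H-row v x≢v x≢w Gvx))
  ... | false | false =
    NajiSolution.eqB solG v w x v≢w (≢-sym x≢v) (≢-sym x≢w) Gvw Gvx Gwx

lemma27 : ∀ {n : ℕ} (G : Adj n) → IsSimple G → IsNaji G →
          (v w : Fin n) → G v w ≡ true →
          (β : Assignment n) → NajiSolution G β → NajiSolution (removeEdge G v w) β →
          (∀ x → inSymDiff G v w x ≡ true → x ≢ v → x ≢ w → β x v ≢ β x w)
          × (∀ x → inSymDiff G v w x ≡ false → β x v ≡ β x w)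
lemma27 G simple _ v w Gvw β solG solH = differs , agrees
  where
  sum≡inSymDiff : ∀ {x} → x ≢ v → x ≢ w → β x v xor β x w ≡ inSymDiff G v w x
  sum≡inSymDiff = xor-β≡inSymDiff simple Gvw solG solH

  differs : ∀ x → inSymDiff G v w x ≡ true → x ≢ v → x ≢ w → β x v ≢ β x w
  differs x x∈Δ x≢v x≢w = xor≡true⇒≢ (trans (sum≡inSymDiff x≢v x≢w) x∈Δ)

  agrees : ∀ x → inSymDiff G v w x ≡ false → β x v ≡ β x w
  agrees x x∉Δ = xor≡false⇒≡ (trans (sum≡inSymDiff x≢v x≢w) x∉Δ)
    where
    x≢v : x ≢ v
    x≢v refl = contradiction (trans (sym (inSymDiff-left simple Gvw)) x∉Δ) λ ()
    x≢w : x ≢ w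
    x≢w refl = contradiction (trans (sym (inSymDiff-right simple Gvw)) x∉Δ) λ ()
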